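{- For any annotated $\infty$-proof $\kappa$, the tree $\mathit{tr}(\kappa)$ is well-founded, i.e. it has no infinite branch.
   Context: Formulas are built from propositional variables and $\bot$ by $\to$, $\Box$, $\Box^+$. An annotated sequent is $\Sigma;\Gamma\Rightarrow_s\Delta$ where $\Gamma,\Delta$ are finite multisets, $\Sigma$ a set of formulas, and $s$ is a formula or the sign $\circ$; if $s$ is a formula then $\Box^+s\in\Delta$. Annotated rules: initial sequents $\Sigma;\Gamma,p\Rightarrow_s p,\Delta$ and $\Sigma;\Gamma,\bot\Rightarrow_s\Delta$; ($\to_L$): from $\Sigma;\Gamma,B\Rightarrow_s\Delta$ and $\Sigma;\Gamma\Rightarrow_s A,\Delta$ infer $\Sigma;\Gamma,A\to B\Rightarrow_s\Delta$; ($\to_R$): from $\Sigma;\Gamma,A\Rightarrow_s B,\Delta$ infer $\Sigma;\Gamma\Rightarrow_s A\to B,\Delta$; ($\mathsf{cut}$): from $\Sigma;\Gamma\Rightarrow_s\Delta,A$ and $\Sigma;A,\Gamma\Rightarrow_s\Delta$ infer $\Sigma;\Gamma\Rightarrow_s\Delta$; ($\Box$): from $\Sigma;\Sigma_0,\Lambda,\Pi,\Box^+\Pi\Rightarrow_\circ A$ infer $\Sigma;\Phi,\Box\Lambda,\Box^+\Pi\Rightarrow_s\Box A,\Psi$; ($\Box^+$): from left premise $\Sigma;\Sigma_0,\Lambda,\Pi,\Box^+\Pi\Rightarrow_\circ A$ and right premise $\Sigma;\Sigma_0,\Lambda,\Pi,\Box^+\Pi\Rightarrow_A\Box^+A$ infer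 $\Sigma;\Phi,\Box\Lambda,\Box^+\Pi\Rightarrow_s\Box^+A,\Psi$; $\Sigma_0$ a finite subset of $\Sigma$. An annotated $\infty$-proof is a possibly infinite tree of annotated sequents built by annotated rules, all leaves annotated initial sequents, such that every infinite branch has a tail in which all sequents carry the same formula annotation and which passes through right premises of ($\Box^+$) infinitely many times. For nodes $a,b$ of $\kappa$, $a\approx_\kappa b$ iff the shortest path between $a$ and $b$ in $\kappa$ does not pass through any application of ($\Box$) (i.e. never goes between the conclusion and premise of a ($\Box$) inference), does not pass from the conclusion of a ($\Box^+$) inference to its left premise, and all sequents on the path have the same annotation. This is an equivalence relation whose classes are connected; $\mathit{tr}(\kappa)$ is the quotient tree whose nodes are the equivalence classes, with $c_1$ adjacent to $c_2$ iff some element of $c_1$ is adjacent in $\kappa$ to some element of $c_2$, rooted at the class of the root of $\kappa$. -}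

module Defs where

open import Data.Nat using (ℕ; zero; suc; _≤_)
open import Data.List using (List; []; _∷_; _++_; map)
open import Data.List.Membership.Propositional using (_∈_)
open import Data.List.Relation.Unary.All using (All)
open import Data.List.Relation.Unary.Unique.Propositional using (Unique)
open import Data.List.Relation.Binary.Permutation.Propositional using (_↭_)
open import Data.Product using (Σ; ∃; ∃-syntax; _×_)
open import Data.Sum using (_⊎_)
open import Data.Empty using (⊥)
open import Data.Unit using (⊤)
open import Relation.Nullary using (¬_)
open import Relation.Binary.PropositionalEquality using (_≡_; _≢_)

data Fm : Set where
  var  : ℕ → Fm
  bot  : Fm
  _⇒_  : Fm → Fm → Fm
  □    : Fm → Fm
  □⁺   : Fm → Fm

data Ann : Set where
  ∘   : Ann
  ann : Fm → Ann

-- Annotated sequents  Σ ; Γ ⇒_s Δ.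
-- Γ, Δ are multisets, represented by lists; rules are matched up to
-- permutation (_↭_).  The set Σ is the same in every rule, hence constant
-- throughout a proof; it is a parameter (a predicate on formulas).

record Seq : Set where
  constructor _⇒[_]_
  field
    ante : List Fm
    an   : Ann
    succ : List Fm
open Seq public

WFSeq : Seq → Set
WFSeq S = ∀ A → an S ≡ ann A → □⁺ A ∈ succ S

FinSub : (Fm → Set) → List Fm → Set
FinSub Σ' Σ₀ = All Σ' Σ₀ × Unique Σ₀

-- Rules.  Premises are numbered in the order written in the paper;
-- for (□⁺), premise 0 is the left premise and premise 1 the right one.

data Rule : Set where
  init-p init-⊥ →L →R cut box box⁺ : Rule

data Dir : Set where
  d₀ d₁ : Dir

Allowed : Rule → Dir → Set
Allowed init-p _  = ⊥
Allowed init-⊥ _  = ⊥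
Allowed →L     _  = ⊤
Allowed →R     d₀ = ⊤
Allowed →R     d₁ = ⊥
Allowed cut    _  = ⊤
Allowed box    d₀ = ⊤
Allowed box    d₁ = ⊥
Allowed box⁺   _  = ⊤

-- Valid Σ r C P₀ P₁ : C follows by rule r from premises P₀ (and P₁);
-- unused premise arguments are ignored.
Valid : (Fm → Set) → Rule → Seq → Seq → Seq → Set
Valid Σ' init-p C P₀ P₁ =
  ∃[ Γ ] ∃[ Δ ] ∃[ p ] (ante C ↭ var p ∷ Γ × succ C ↭ var p ∷ Δ)
Valid Σ' init-⊥ C P₀ P₁ =
  ∃[ Γ ] (ante C ↭ bot ∷ Γ)
Valid Σ' →L C P₀ P₁ =
  ∃[ Γ ] ∃[ Δ ] ∃[ A ] ∃[ B ]
    ( ante C ↭ (A ⇒ B) ∷ Γ × succ C ↭ Δ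
    × ante P₀ ↭ B ∷ Γ × succ P₀ ↭ Δ × an P₀ ≡ an C
    × ante P₁ ↭ Γ × succ P₁ ↭ A ∷ Δ × an P₁ ≡ an C )
Valid Σ' →R C P₀ P₁ =
  ∃[ Γ ] ∃[ Δ ] ∃[ A ] ∃[ B ]
    ( ante C ↭ Γ × succ C ↭ (A ⇒ B) ∷ Δ
    × ante P₀ ↭ A ∷ Γ × succ P₀ ↭ B ∷ Δ × an P₀ ≡ an C )
Valid Σ' cut C P₀ P₁ =
  ∃[ Γ ] ∃[ Δ ] ∃[ A ]
    ( ante C ↭ Γ × succ C ↭ Δ
    × ante P₀ ↭ Γ × succ P₀ ↭ Δ ++ A ∷ [] × an P₀ ≡ an C
    × ante P₁ ↭ A ∷ Γ × succ P₁ ↭ Δ × an P₁ ≡ an C )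
Valid Σ' box C P₀ P₁ =
  ∃[ Σ₀ ] ∃[ Φ ] ∃[ Λ ] ∃[ Π ] ∃[ Ψ ] ∃[ A ]
    ( FinSub Σ' Σ₀
    × ante C ↭ Φ ++ map □ Λ ++ map □⁺ Π × succ C ↭ □ A ∷ Ψ
    × ante P₀ ↭ Σ₀ ++ Λ ++ Π ++ map □⁺ Π × succ P₀ ↭ A ∷ [] × an P₀ ≡ ∘ )
Valid Σ' box⁺ C P₀ P₁ =
  ∃[ Σ₀ ] ∃[ Φ ] ∃[ Λ ] ∃[ Π ] ∃[ Ψ ] ∃[ A ]
    ( FinSub Σ' Σ₀
    × ante C ↭ Φ ++ map □ Λ ++ map □⁺ Π × succ C ↭ □⁺ A ∷ Ψ
    × ante P₀ ↭ Σ₀ ++ Λ ++ Π ++ map □⁺ Π × succ P₀ ↭ A ∷ [] × an P₀ ≡ ∘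
    × ante P₁ ↭ Σ₀ ++ Λ ++ Π ++ map □⁺ Π × succ P₁ ↭ □⁺ A ∷ [] × an P₁ ≡ ann A )

-- An address is the list of premise choices from the root, MOST RECENT
-- CHOICE FIRST: the d-th premise of the node at address a is at d ∷ a.

Addr : Set
Addr = List Dir

record PreProof : Set where
  field
    seq  : Addr → Seq
    rule : Addr → Rule
  -- (values at addresses that are not nodes are irrelevant)
open PreProof public

module _ (κ : PreProof) where

  data Node : Addr → Set where
    root  : Node []
    child : ∀ {a} d → Node a → Allowed (rule κ a) d → Node (d ∷ a)

  branch : (ℕ → Dir) → ℕ → Addr
  branch f zero    = []
  branch f (suc n) = f n ∷ branch f n

  IsBranch : (ℕ → Dir) → Set
  IsBranch f = ∀ n → Node (branch f n)

record IsInfProof (Σ' : Fm → Set) (κ : PreProof) : Set₁ where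
  field
    wf    : ∀ a → Node κ a → WFSeq (seq κ a)
    -- every node is the conclusion of its rule, the premises being its
    -- children; rules without premises are the initial sequents, so all
    -- leaves are annotated initial sequents
    valid : ∀ a → Node κ a →
      Valid Σ' (rule κ a) (seq κ a) (seq κ (d₀ ∷ a)) (seq κ (d₁ ∷ a))
    progress : ∀ f → IsBranch κ f →
      ∃[ N ] ∃[ A ]
        ( (∀ n → N ≤ n → an (seq κ (branch κ f n)) ≡ ann A)
        × (∀ m → ∃[ n ] (m ≤ n × N ≤ n
                 × rule κ (branch κ f n) ≡ box⁺ × f n ≡ d₁)) )

module _ (κ : PreProof) where

  _≼_ : Addr → Addr → Set
  b ≼ a = ∃[ s ] (a ≡ s ++ b)

  Meet : Addr → Addr → Addr → Set
  Meet p a b = p ≼ a × p ≼ b × (∀ q → q ≼ a → q ≼ b → q ≼ p)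

  Passable : Addr → Dir → Set
  Passable a d = rule κ a ≢ box × (rule κ a ≡ box⁺ → d ≢ d₀)
               × an (seq κ (d ∷ a)) ≡ an (seq κ a)

  data Seg (p : Addr) : Addr → Set where
    here : Seg p p
    down : ∀ {a} d → Seg p a → Passable a d → Seg p (d ∷ a)

  _≈κ_ : Addr → Addr → Set
  a ≈κ b = Node κ a × Node κ b × ∃[ p ] (Meet p a b × Seg p a × Seg p b)

  -- tr(κ): classes of ≈κ (represented by their elements), adjacent iff
  -- some elements are adjacent in κ, rooted at the class of the root.

  AdjNode : Addr → Addr → Set
  AdjNode a b = Node κ a × Node κ b × ((∃[ d ] b ≡ d ∷ a) ⊎ (∃[ d ] a ≡ d ∷ b))

  AdjClass : Addr → Addr → Set
  AdjClass a b = ∃[ a' ] ∃[ b' ] (a ≈κ a' × b ≈κ b' × AdjNode a' b')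

  TrInfBranch : Set
  TrInfBranch = Σ (ℕ → Addr) λ x →
      ((n : ℕ) → Node κ (x n))
    × (x 0 ≈κ [])
    × ((n : ℕ) → AdjClass (x n) (x (suc n)))
    × ((m n : ℕ) → x m ≈κ x n → m ≡ n)

TrWellFounded : PreProof → Set
TrWellFounded κ = ¬ TrInfBranch κ

-- Every ≈κ-class has a topmost node, reached from any of its members by
-- climbing passable edges, and two nodes are ≈κ-equivalent exactly when
-- they have the same topmost node.  Along an infinite branch of tr(κ) that
-- starts at the root class and never revisits a class, each step must
-- therefore cross an impassable edge downwards, so the topmost nodes form a
-- strictly descending chain in κ and determine an infinite branch of κ.  On
-- the tail of that branch where all annotations are one formula A, no edge is
-- impassable: (□) and the left premise of (□⁺) carry the annotation ∘.
module Submission where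

open import Defs
open import Data.Nat using (ℕ; zero; suc; _≤_; _<_; _≤′_; _∸_; z≤n; s≤s; s≤s⁻¹; ≤′-refl; ≤′-step)
import Data.Nat as ℕ
open import Data.Nat.Properties using (≤-refl; ≤-trans; ≤-reflexive; <-irrefl; m≤n+m; m≤n⇒m≤1+n; +-∸-assoc; m∸n≤m; n∸n≡0; ≤⇒≤′)
open import Data.List using ([]; _∷_; _++_; length; drop)
open import Data.List.Properties using (length-++; ++-assoc; ∷-injective; ≡-dec; drop-all)
open import Data.Product using (∃-syntax; _×_; _,_; proj₁; proj₂)
open import Data.Sum using (_⊎_; inj₁; inj₂; [_,_])
open import Data.Empty using (⊥-elim)
open import Relation.Nullary using (¬_; Dec; yes; no)
open import Relation.Nullary.Decidable using (map′; _×-dec_)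
open import Relation.Binary.Definitions using (DecidableEquality)
open import Relation.Binary.PropositionalEquality using (_≡_; _≢_; refl; sym; trans; cong; subst; subst₂; module ≡-Reasoning)

_≟ᵈ_ : DecidableEquality Dir
d₀ ≟ᵈ d₀ = yes refl
d₁ ≟ᵈ d₁ = yes refl
d₀ ≟ᵈ d₁ = no λ ()
d₁ ≟ᵈ d₀ = no λ ()

_≟ᶠ_ : DecidableEquality Fm
var m   ≟ᶠ var n   = map′ (cong var) (λ { refl → refl }) (m ℕ.≟ n)
bot     ≟ᶠ bot     = yes refl
(A ⇒ B) ≟ᶠ (C ⇒ D) = map′ (λ { (refl , refl) → refl }) (λ { refl → refl , refl }) (A ≟ᶠ C ×-dec B ≟ᶠ D)
□ A     ≟ᶠ □ B     = map′ (cong □) (λ { refl → refl }) (A ≟ᶠ B)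
□⁺ A    ≟ᶠ □⁺ B    = map′ (cong □⁺) (λ { refl → refl }) (A ≟ᶠ B)
var _   ≟ᶠ bot     = no λ ()
var _   ≟ᶠ (_ ⇒ _) = no λ ()
var _   ≟ᶠ □ _     = no λ ()
var _   ≟ᶠ □⁺ _    = no λ ()
bot     ≟ᶠ var _   = no λ ()
bot     ≟ᶠ (_ ⇒ _) = no λ ()
bot     ≟ᶠ □ _     = no λ ()
bot     ≟ᶠ □⁺ _    = no λ ()
(_ ⇒ _) ≟ᶠ var _   = no λ ()
(_ ⇒ _) ≟ᶠ bot     = no λ ()
(_ ⇒ _) ≟ᶠ □ _     = no λ ()
(_ ⇒ _) ≟ᶠ □⁺ _    = no λ ()
□ _     ≟ᶠ var _   = no λ ()
□ _     ≟ᶠ bot     = no λ ()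
□ _     ≟ᶠ (_ ⇒ _) = no λ ()
□ _     ≟ᶠ □⁺ _    = no λ ()
□⁺ _    ≟ᶠ var _   = no λ ()
□⁺ _    ≟ᶠ bot     = no λ ()
□⁺ _    ≟ᶠ (_ ⇒ _) = no λ ()
□⁺ _    ≟ᶠ □ _     = no λ ()

_≟ᵃ_ : DecidableEquality Ann
∘     ≟ᵃ ∘     = yes refl
ann A ≟ᵃ ann B = map′ (cong ann) (λ { refl → refl }) (A ≟ᶠ B)
∘     ≟ᵃ ann _ = no λ ()
ann _ ≟ᵃ ∘     = no λ ()

-- _≼_ and branch take κ only as an unused parameter.
module Ancestors (κ : PreProof) where

  infix 4 _⊑_ _⊏_ _⊑?_

  _⊑_ : Addr → Addr → Set
  _⊑_ = _≼_ κ

  _⊏_ : Addr → Addr → Set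
  p ⊏ a = ∃[ d ] ∃[ b ] (a ≡ d ∷ b × p ⊑ b)

  ⊑-refl : ∀ {a} → a ⊑ a
  ⊑-refl = [] , refl

  ⊑-trans : ∀ {a b c} → a ⊑ b → b ⊑ c → a ⊑ c
  ⊑-trans {a = a} (s , refl) (t , refl) = t ++ s , sym (++-assoc t s a)

  ⊑-∷ : ∀ {d a} → a ⊑ d ∷ a
  ⊑-∷ {d} = d ∷ [] , refl

  []⊑ : ∀ a → [] ⊑ a
  []⊑ [] = ⊑-refl
  []⊑ (d ∷ a) = ⊑-trans ([]⊑ a) ⊑-∷

  ⊏⇒⊑ : ∀ {p a} → p ⊏ a → p ⊑ a
  ⊏⇒⊑ (_ , _ , refl , p⊑b) = ⊑-trans p⊑b ⊑-∷

  ⊑-∷⁻ : ∀ {q d a} → q ⊑ d ∷ a → q ≡ d ∷ a ⊎ q ⊑ a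
  ⊑-∷⁻ ([] , eq) = inj₁ (sym eq)
  ⊑-∷⁻ (_ ∷ s , eq) = inj₂ (s , proj₂ (∷-injective eq))

  ⊑-length : ∀ {p a} → p ⊑ a → length p ≤ length a
  ⊑-length {p} (s , refl) = ≤-trans (m≤n+m (length p) (length s)) (≤-reflexive (sym (length-++ s)))

  ⊑-antisym : ∀ {p a} → p ⊑ a → a ⊑ p → p ≡ a
  ⊑-antisym ([] , refl) _ = refl
  ⊑-antisym (_ ∷ s , refl) a⊑p =
    ⊥-elim (<-irrefl refl (≤-trans (s≤s (⊑-length (s , refl))) (⊑-length a⊑p)))

  _⊑?_ : ∀ q a → Dec (q ⊑ a)
  [] ⊑? [] = yes ⊑-refl
  (_ ∷ _) ⊑? [] = no λ { ([] , ()) ; (_ ∷ _ , ()) }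
  q ⊑? (d ∷ a) with ≡-dec _≟ᵈ_ q (d ∷ a) | q ⊑? a
  ... | yes refl | _        = yes ⊑-refl
  ... | no _     | yes q⊑a = yes (⊑-trans q⊑a ⊑-∷)
  ... | no q≢da  | no q⋢a  = no λ q⊑da → [ q≢da , q⋢a ] (⊑-∷⁻ q⊑da)

  meet : ∀ a b → ∃[ p ] Meet κ p a b
  meet [] b = [] , ⊑-refl , []⊑ b , λ _ q⊑[] _ → q⊑[]
  meet (d ∷ a) b with d ∷ a ⊑? b
  ... | yes da⊑b = d ∷ a , ⊑-refl , da⊑b , λ _ q⊑da _ → q⊑da
  ... | no da⋢b with meet a b
  ...   | p , p⊑a , p⊑b , greatest = p , ⊑-trans p⊑a ⊑-∷ , p⊑b , below
    where
    below : ∀ q → q ⊑ d ∷ a → q ⊑ b → q ⊑ p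
    below q q⊑da q⊑b = [ (λ q≡da → ⊥-elim (da⋢b (subst (_⊑ b) q≡da q⊑b))) , (λ q⊑a → greatest q q⊑a q⊑b) ] (⊑-∷⁻ q⊑da)

  ⊑-Node : ∀ {q a} → q ⊑ a → Node κ a → Node κ q
  ⊑-Node ([] , refl) n = n
  ⊑-Node (_ ∷ s , refl) (child _ n _) = ⊑-Node (s , refl) n

  ancestorAt : ℕ → Addr → Addr
  ancestorAt k a = drop (length a ∸ k) a

  drop-⊑ : ∀ j (a : Addr) → drop j a ⊑ a
  drop-⊑ zero a = ⊑-refl
  drop-⊑ (suc j) [] = ⊑-refl
  drop-⊑ (suc j) (_ ∷ a) = ⊑-trans (drop-⊑ j a) ⊑-∷

  drop-∷ : ∀ j (a : Addr) → j < length a → ∃[ d ] drop j a ≡ d ∷ drop (suc j) a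
  drop-∷ zero (d ∷ a) _ = d , refl
  drop-∷ (suc j) (_ ∷ a) j<a = drop-∷ j a (s≤s⁻¹ j<a)

  drop-length-++ : ∀ (s : Addr) j b → drop (length s ℕ.+ j) (s ++ b) ≡ drop j b
  drop-length-++ [] j b = refl
  drop-length-++ (_ ∷ s) j b = drop-length-++ s j b

  ancestorAt-suc : ∀ k (a : Addr) → k < length a → ∃[ d ] ancestorAt (suc k) a ≡ d ∷ ancestorAt k a
  ancestorAt-suc k a k<a =
    subst (λ j → ∃[ d ] drop (length a ∸ suc k) a ≡ d ∷ drop j a) (sym a∸k≡1+a∸1+k)
      (drop-∷ (length a ∸ suc k) a (subst (_≤ length a) a∸k≡1+a∸1+k (m∸n≤m (length a) k)))
    where
    a∸k≡1+a∸1+k : length a ∸ k ≡ suc (length a ∸ suc k)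
    a∸k≡1+a∸1+k = +-∸-assoc 1 k<a

  ancestorAt-⊑ : ∀ {k a b} → b ⊑ a → k ≤ length b → ancestorAt k a ≡ ancestorAt k b
  ancestorAt-⊑ {k} {b = b} (s , refl) k≤b = begin
    drop (length (s ++ b) ∸ k) (s ++ b)         ≡⟨ cong (λ n → drop (n ∸ k) (s ++ b)) (length-++ s) ⟩
    drop (length s ℕ.+ length b ∸ k) (s ++ b)   ≡⟨ cong (λ n → drop n (s ++ b)) (+-∸-assoc (length s) k≤b) ⟩
    drop (length s ℕ.+ (length b ∸ k)) (s ++ b) ≡⟨ drop-length-++ s (length b ∸ k) b ⟩
    drop (length b ∸ k) b                       ∎
    where open ≡-Reasoning

  ancestorAt-length : ∀ (a : Addr) → ancestorAt (length a) a ≡ a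
  ancestorAt-length a = cong (λ n → drop n a) (n∸n≡0 (length a))

  ancestorAt-zero : ∀ (a : Addr) → ancestorAt 0 a ≡ []
  ancestorAt-zero a = drop-all (length a) a ≤-refl

  ⊏-chain-depth : (T : ℕ → Addr) → (∀ n → T n ⊏ T (suc n)) → ∀ n → n ≤ length (T n)
  ⊏-chain-depth T chain zero = z≤n
  ⊏-chain-depth T chain (suc n) with chain n
  ... | _ , _ , eq , Tn⊑b rewrite eq = s≤s (≤-trans (⊏-chain-depth T chain n) (⊑-length Tn⊑b))

  ⊏-chain⇒branch : (T : ℕ → Addr) → (∀ n → T n ⊏ T (suc n)) →
    ∃[ f ] ((∀ n → branch κ f n ⊑ T n) × (∀ n → branch κ f (length (T n)) ≡ T n))
  ⊏-chain⇒branch T chain = f , through , reaches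
    where
    open ≡-Reasoning

    depth : ∀ n → n ≤ length (T n)
    depth = ⊏-chain-depth T chain

    mono : ∀ {m n} → m ≤′ n → T m ⊑ T n
    mono ≤′-refl = ⊑-refl
    mono (≤′-step m≤′n) = ⊑-trans (mono m≤′n) (⊏⇒⊑ (chain _))

    f : ℕ → Dir
    f k = proj₁ (ancestorAt-suc k (T (suc k)) (depth (suc k)))

    branch≡ancestor : ∀ k → branch κ f k ≡ ancestorAt k (T k)
    branch≡ancestor zero = sym (ancestorAt-zero (T 0))
    branch≡ancestor (suc k) = begin
      f k ∷ branch κ f k               ≡⟨ cong (f k ∷_) (branch≡ancestor k) ⟩
      f k ∷ ancestorAt k (T k)         ≡⟨ cong (f k ∷_) (sym (ancestorAt-⊑ (mono (≤′-step ≤′-refl)) (depth k))) ⟩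
      f k ∷ ancestorAt k (T (suc k))   ≡⟨ sym (proj₂ (ancestorAt-suc k (T (suc k)) (depth (suc k)))) ⟩
      ancestorAt (suc k) (T (suc k))   ∎

    through : ∀ n → branch κ f n ⊑ T n
    through n = subst (_⊑ T n) (sym (branch≡ancestor n)) (drop-⊑ (length (T n) ∸ n) (T n))

    reaches : ∀ n → branch κ f (length (T n)) ≡ T n
    reaches n = begin
      branch κ f (length (T n))                    ≡⟨ branch≡ancestor (length (T n)) ⟩
      ancestorAt (length (T n)) (T (length (T n))) ≡⟨ ancestorAt-⊑ (mono (≤⇒≤′ (depth n))) ≤-refl ⟩
      ancestorAt (length (T n)) (T n)              ≡⟨ ancestorAt-length (T n) ⟩
      T n                                          ∎

module Classes (κ : PreProof) where

  open Ancestors κ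

  rule-passable? : ∀ r d → Dec (r ≢ box × (r ≡ box⁺ → d ≢ d₀))
  rule-passable? box  _  = no λ (r≢box , _) → r≢box refl
  rule-passable? box⁺ d₀ = no λ (_ , right) → right refl refl
  rule-passable? box⁺ d₁ = yes ((λ ()) , λ _ ())
  rule-passable? init-p _ = yes ((λ ()) , λ ())
  rule-passable? init-⊥ _ = yes ((λ ()) , λ ())
  rule-passable? →L    _ = yes ((λ ()) , λ ())
  rule-passable? →R    _ = yes ((λ ()) , λ ())
  rule-passable? cut   _ = yes ((λ ()) , λ ())

  passable? : ∀ a d → Dec (Passable κ a d)
  passable? a d =
    map′ (λ ((r≢box , right) , same) → r≢box , right , same)
         (λ (r≢box , right , same) → (r≢box , right) , same)
         (rule-passable? (rule κ a) d ×-dec an (seq κ (d ∷ a)) ≟ᵃ an (seq κ a))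

  top : Addr → Addr
  top [] = []
  top (d ∷ a) with passable? a d
  ... | yes _ = top a
  ... | no _  = d ∷ a

  top-passable : ∀ {a d} → Passable κ a d → top (d ∷ a) ≡ top a
  top-passable {a} {d} pass with passable? a d
  ... | yes _     = refl
  ... | no ¬pass = ⊥-elim (¬pass pass)

  top-impassable : ∀ {a d} → ¬ Passable κ a d → top (d ∷ a) ≡ d ∷ a
  top-impassable {a} {d} ¬pass with passable? a d
  ... | yes pass = ⊥-elim (¬pass pass)
  ... | no _     = refl

  Seg-top : ∀ a → Seg κ (top a) a
  Seg-top [] = here
  Seg-top (d ∷ a) with passable? a d
  ... | yes pass = down d (Seg-top a) pass
  ... | no _     = here

  Seg⇒⊑ : ∀ {p a} → Seg κ p a → p ⊑ a
  Seg⇒⊑ here = ⊑-refl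
  Seg⇒⊑ (down _ s _) = ⊑-trans (Seg⇒⊑ s) ⊑-∷

  top-⊑ : ∀ a → top a ⊑ a
  top-⊑ a = Seg⇒⊑ (Seg-top a)

  Seg⇒top≡ : ∀ {p a} → Seg κ p a → top a ≡ top p
  Seg⇒top≡ here = refl
  Seg⇒top≡ (down _ s pass) = trans (top-passable pass) (Seg⇒top≡ s)

  Seg-shorten : ∀ {t p a} → Seg κ t a → t ⊑ p → p ⊑ a → Seg κ p a
  Seg-shorten here t⊑p p⊑t = subst (λ q → Seg κ q _) (⊑-antisym t⊑p p⊑t) here
  Seg-shorten (down d s pass) t⊑p p⊑da with ⊑-∷⁻ p⊑da
  ... | inj₁ refl = here
  ... | inj₂ p⊑a  = down d (Seg-shorten s t⊑p p⊑a) pass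

  ≈⇒top≡ : ∀ {a b} → _≈κ_ κ a b → top a ≡ top b
  ≈⇒top≡ (_ , _ , _ , _ , sa , sb) = trans (Seg⇒top≡ sa) (sym (Seg⇒top≡ sb))

  top≡⇒≈ : ∀ {a b} → Node κ a → Node κ b → top a ≡ top b → _≈κ_ κ a b
  top≡⇒≈ {a} {b} na nb ta≡tb with meet a b
  ... | p , p⊑a , p⊑b , greatest =
    na , nb , p , (p⊑a , p⊑b , greatest) ,
    Seg-shorten (Seg-top a) ta⊑p p⊑a , Seg-shorten (Seg-top b) (subst (_⊑ p) ta≡tb ta⊑p) p⊑b
    where
    ta⊑p : top a ⊑ p
    ta⊑p = greatest (top a) (top-⊑ a) (subst (_⊑ b) (sym ta≡tb) (top-⊑ b))

module _ {Σ' : Fm → Set} {κ : PreProof} (P : IsInfProof Σ' κ) where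

  open IsInfProof P

  modal-left-premise-unannotated : ∀ {r C P₀ P₁} → r ≡ box ⊎ r ≡ box⁺ → Valid Σ' r C P₀ P₁ → an P₀ ≡ ∘
  modal-left-premise-unannotated (inj₁ refl) (_ , _ , _ , _ , _ , _ , _ , _ , _ , _ , _ , P₀∘) = P₀∘
  modal-left-premise-unannotated (inj₂ refl) (_ , _ , _ , _ , _ , _ , _ , _ , _ , _ , _ , P₀∘ , _) = P₀∘

  box-premise-left : ∀ {r d} → r ≡ box → Allowed r d → d ≡ d₀
  box-premise-left {d = d₀} refl _ = refl

  formula-annotated-edge-passable : ∀ {a d A} → Node κ (d ∷ a) →
    an (seq κ a) ≡ ann A → an (seq κ (d ∷ a)) ≡ ann A → Passable κ a d
  formula-annotated-edge-passable {a} {d} (child .d na allowed) a-ann da-ann =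
    not-box , not-left-of-box⁺ , trans da-ann (sym a-ann)
    where
    ann≢∘ : ∀ {B} → ann B ≢ ∘
    ann≢∘ ()
    not-box : rule κ a ≢ box
    not-box r≡box with box-premise-left r≡box allowed
    ... | refl = ann≢∘ (trans (sym da-ann) (modal-left-premise-unannotated (inj₁ r≡box) (valid a na)))
    not-left-of-box⁺ : rule κ a ≡ box⁺ → d ≢ d₀
    not-left-of-box⁺ r≡box⁺ refl = ann≢∘ (trans (sym da-ann) (modal-left-premise-unannotated (inj₂ r≡box⁺) (valid a na)))

  tail-edge-passable : ∀ {f N A} → IsBranch κ f → (∀ n → N ≤ n → an (seq κ (branch κ f n)) ≡ ann A) →
    ∀ {n} → N ≤ n → Passable κ (branch κ f n) (f n)
  tail-edge-passable isBranch annotated N≤n =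
    formula-annotated-edge-passable (isBranch (suc _)) (annotated _ N≤n) (annotated (suc _) (m≤n⇒m≤1+n N≤n))

module TrBranch (κ : PreProof) (x : ℕ → Addr) (node : ∀ n → Node κ (x n))
  (starts-at-root : _≈κ_ κ (x 0) []) (adjacent : ∀ n → AdjClass κ (x n) (x (suc n)))
  (distinct : ∀ m n → _≈κ_ κ (x m) (x n) → m ≡ n) where

  open Ancestors κ
  open Classes κ

  T : ℕ → Addr
  T n = top (x n)

  T-injective : ∀ {m n} → T m ≡ T n → m ≡ n
  T-injective Tm≡Tn = distinct _ _ (top≡⇒≈ (node _) (node _) Tm≡Tn)

  T-Node : ∀ n → Node κ (T n)
  T-Node n = ⊑-Node (top-⊑ (x n)) (node n)

  consecutive-T-differ : ∀ n → T n ≢ T (suc n)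
  consecutive-T-differ n Tn≡Tn+1 with T-injective Tn≡Tn+1
  ... | ()

  Descent : ℕ → Set
  Descent n = ∃[ d ] ∃[ a ] (T (suc n) ≡ d ∷ a × T n ≡ top a × ¬ Passable κ a d)

  Ascent : ℕ → Set
  Ascent n = ∃[ d ] ∃[ b ] (T n ≡ d ∷ b × T (suc n) ≡ top b)

  descent-or-ascent : ∀ n → Descent n ⊎ Ascent n
  descent-or-ascent n with adjacent n
  ... | a , _ , xₙ≈a , xₙ₊₁≈da , _ , _ , inj₁ (d , refl) with passable? a d
  ...   | yes pass = ⊥-elim (consecutive-T-differ n
            (trans (≈⇒top≡ xₙ≈a) (trans (sym (top-passable pass)) (sym (≈⇒top≡ xₙ₊₁≈da)))))
  ...   | no ¬pass = inj₁ (d , a , trans (≈⇒top≡ xₙ₊₁≈da) (top-impassable ¬pass) , ≈⇒top≡ xₙ≈a , ¬pass)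
  descent-or-ascent n | _ , b , xₙ≈db , xₙ₊₁≈b , _ , _ , inj₂ (d , refl) with passable? b d
  ...   | yes pass = ⊥-elim (consecutive-T-differ n
            (trans (≈⇒top≡ xₙ≈db) (trans (top-passable pass) (sym (≈⇒top≡ xₙ₊₁≈b)))))
  ...   | no ¬pass = inj₂ (d , b , trans (≈⇒top≡ xₙ≈db) (top-impassable ¬pass) , ≈⇒top≡ xₙ₊₁≈b)

  -- An ascent would leave the root class (n = 0) or return to the class
  -- preceding the last descent.
  descends : ∀ n → Descent n
  descends zero with descent-or-ascent zero
  ... | inj₁ descent = descent
  ... | inj₂ (_ , _ , T₀≡db , _) with trans (sym (≈⇒top≡ starts-at-root)) T₀≡db
  ...   | ()
  descends (suc n) with descent-or-ascent (suc n)
  ... | inj₁ descent = descent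
  ... | inj₂ (_ , _ , Tₙ₊₁≡eb , Tₙ₊₂≡tb) with descends n
  ...   | _ , _ , Tₙ₊₁≡da , Tₙ≡ta , _ with trans (sym Tₙ₊₁≡eb) Tₙ₊₁≡da
  ...     | refl with T-injective (trans Tₙ≡ta (sym Tₙ₊₂≡tb))
  ...       | ()

  T-⊏ : ∀ n → T n ⊏ T (suc n)
  T-⊏ n with descends n
  ... | d , a , Tₙ₊₁≡da , Tₙ≡ta , _ = d , a , Tₙ₊₁≡da , subst (_⊑ a) (sym Tₙ≡ta) (top-⊑ a)

proposition4 : (Σ' : Fm → Set) (κ : PreProof) → IsInfProof Σ' κ → TrWellFounded κ
proposition4 Σ' κ P (x , node , starts-at-root , adjacent , distinct) =
  let open Ancestors κ
      open TrBranch κ x node starts-at-root adjacent distinct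
      open IsInfProof P
      (f , f⊑T , f-reaches) = ⊏-chain⇒branch T T-⊏
      f-isBranch : IsBranch κ f
      f-isBranch n = ⊑-Node (f⊑T n) (T-Node n)
      (N , A , annotated , _) = progress f f-isBranch
      (d , a , Tₙ₊₁≡da , _ , ¬pass) = descends N
      N≤a : N ≤ length a
      N≤a = s≤s⁻¹ (subst (λ t → suc N ≤ length t) Tₙ₊₁≡da (⊏-chain-depth T T-⊏ (suc N)))
      (f≡d , branch≡a) = ∷-injective (subst (λ t → branch κ f (length t) ≡ t) Tₙ₊₁≡da (f-reaches (suc N)))
  in ¬pass (subst₂ (Passable κ) branch≡a f≡d (tail-edge-passable P f-isBranch annotated N≤a))
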